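{- Let $G_D=([m],E_D)$ be a graph and $\mathcal M\subseteq E_D$ a matching. For any wdag $D$ of $G_D$ there exists a set $\mathcal P$ of pairwise node-disjoint $\mathcal M$-reversible arcs of $D$ such that for every $i\in[m]$ that is an endpoint of an edge of $\mathcal M$, \[ \big|\{v:\ L(v)=i,\ v\text{ is an endpoint of some arc in }\mathcal P\}\big|\ \ge\ \tfrac12\,|\mathcal V(D,i)|. \]
   Context: Witness DAG (wdag) of $G_D$: a finite DAG with node labels $L(v)\in[m]$ such that for distinct nodes $v,v'$ there is an arc between them (in either direction) iff $L(v)=L(v')$ or $(L(v),L(v'))\in E_D$. An arc $u\to v$ is reversible in $D$ if reversing its direction yields a DAG; it is $\mathcal M$-reversible if moreover $(L(u),L(v))\in\mathcal M$ (as an unordered edge). $\mathcal V(D)$ is the set of nodes incident to some $\mathcal M$-reversible arc of $D$, and $\mathcal V(D,i)=\{v\in\mathcal V(D):L(v)=i\}$. -}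

module Defs where

open import Data.Nat using (ℕ)
open import Data.Bool using (Bool; true)
open import Data.Fin using (Fin)
open import Data.Fin.Subset using (Subset; _∈_)
open import Data.Product using (_×_; _,_; proj₁; proj₂; Σ; ∃)
open import Data.Sum using (_⊎_)
open import Data.List using (List)
open import Data.List.Relation.Unary.Any using (Any)
open import Data.List.Relation.Unary.All using (All)
open import Data.List.Relation.Unary.AllPairs using (AllPairs)
open import Relation.Binary.PropositionalEquality using (_≡_; _≢_)
open import Relation.Binary.Construct.Closure.Transitive using (TransClosure)
open import Relation.Nullary using (¬_)
open import Function.Bundles using (_⇔_)

record Graph (m : ℕ) : Set where
  field
    edge   : Fin m → Fin m → Bool
    sym    : ∀ i j → edge i j ≡ true → edge j i ≡ true
    irrefl : ∀ i → ¬ (edge i i ≡ true)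

record Matching {m : ℕ} (G : Graph m) : Set where
  field
    medge   : Fin m → Fin m → Bool
    sub     : ∀ i j → medge i j ≡ true → Graph.edge G i j ≡ true
    msym    : ∀ i j → medge i j ≡ true → medge j i ≡ true
    unique  : ∀ i j k → medge i j ≡ true → medge i k ≡ true → j ≡ k

Arcs : ℕ → Set
Arcs n = Fin n → Fin n → Bool

_⟶[_]_ : ∀ {n} → Fin n → Arcs n → Fin n → Set
u ⟶[ A ] v = A u v ≡ true

Acyclic : ∀ {n} → Arcs n → Set
Acyclic {n} A = ∀ (v : Fin n) → ¬ TransClosure (λ x y → x ⟶[ A ] y) v v

reverseArc : ∀ {n} → Arcs n → Fin n → Fin n → (Fin n → Fin n → Set)
reverseArc A u v x y = ((x ⟶[ A ] y) × ¬ (x ≡ u × y ≡ v)) ⊎ (x ≡ v × y ≡ u)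

AcyclicRel : ∀ {n} → (Fin n → Fin n → Set) → Set
AcyclicRel {n} R = ∀ (v : Fin n) → ¬ TransClosure R v v

record WDAG {m : ℕ} (G : Graph m) : Set where
  field
    n       : ℕ
    label   : Fin n → Fin m
    arc     : Arcs n
    acyclic : Acyclic arc
    witness : ∀ (v v' : Fin n) → v ≢ v' →
              ((v ⟶[ arc ] v') ⊎ (v' ⟶[ arc ] v)) ⇔
              ((label v ≡ label v') ⊎ (Graph.edge G (label v) (label v') ≡ true))

module _ {m : ℕ} {G : Graph m} (M : Matching G) (D : WDAG G) where
  open WDAG D

  Reversible : Fin n → Fin n → Set
  Reversible u v = (u ⟶[ arc ] v) × AcyclicRel (reverseArc arc u v)

  MReversible : Fin n → Fin n → Set
  MReversible u v = Reversible u v × Matching.medge M (label u) (label v) ≡ true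

  InV : Fin n → Set
  InV w = ∃ λ (x : Fin n) → MReversible w x ⊎ MReversible x w

  InVi : Fin m → Fin n → Set
  InVi i w = InV w × label w ≡ i

  -- arcs as ordered pairs (tail , head)
  NodeDisjoint : (Fin n × Fin n) → (Fin n × Fin n) → Set
  NodeDisjoint (a , b) (c , d) = a ≢ c × a ≢ d × b ≢ c × b ≢ d

  EndpointOf : List (Fin n × Fin n) → Fin n → Set
  EndpointOf P w = Any (λ e → w ≡ proj₁ e ⊎ w ≡ proj₂ e) P

_Represents_ : ∀ {n} → Subset n → (Fin n → Set) → Set
S Represents P = ∀ x → (x ∈ S) ⇔ P x

MEndpoint : ∀ {m} {G : Graph m} → Matching G → Fin m → Set
MEndpoint M i = ∃ λ j → Matching.medge M i j ≡ true

module Submission where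

-- An arc u ⟶ v of a DAG is reversible iff it is the only path from u to v, so reversibility
-- is decidable and a maximal node-disjoint list P of M-reversible arcs is found greedily. An uncovered u ∈ 𝒱(D,i) is M-reversibly joined to some y, which is covered
-- by maximality, and the partner x of y in P has label i because M is a matching. The map
-- u ↦ x is injective: nodes of one label are pairwise joined by arcs, so three of them lie on
-- a path a ⟶ b ⟶ c, and no node is reversibly joined to all three. Hence 𝒱(D,i) has at most
-- as many uncovered nodes as there are covered nodes of label i.

open import Defs hiding (Reversible)
open import Data.Nat using (ℕ; zero; suc; _+_; _*_; _≤_; z≤n; s≤s)
import Data.Nat.Properties as ℕ
open import Data.Bool using (true; false)
import Data.Bool.Properties as Bool
open import Data.Fin using (Fin)
import Data.Fin.Properties as Fin
open import Data.Fin.Induction using (spo-noetherian)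
open import Data.Fin.Subset using (Subset; inside; outside; _∈_; _∉_; _─_; _-_; ⁅_⁆; ∣_∣)
open import Data.Fin.Subset.Properties
  using (nonempty?; Empty-unique; ∣⊥∣≡0; ∣⁅x⁆∣≡1; p─q⊆p; x∈p⇒∣p-x∣<∣p∣; x∈p∧x≢y⇒x∈p-y; x∉⁅y⁆⇒x≢y)
open import Data.Vec using ([]; _∷_; there)
open import Data.Product using (Σ; ∃-syntax; _×_; _,_; proj₁; proj₂)
open import Data.Sum using (_⊎_; inj₁; inj₂)
import Data.Sum as Sum
open import Data.Empty using (⊥; ⊥-elim)
open import Data.List using (List; []; _∷_; cartesianProduct; allFin)
open import Data.List.Relation.Unary.Any using (Any; here; there; any?)
import Data.List.Relation.Unary.Any as Any
open import Data.List.Relation.Unary.All using (All; []; _∷_)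
import Data.List.Relation.Unary.All as All
open import Data.List.Relation.Unary.All.Properties using (All¬⇒¬Any; ¬Any⇒All¬)
open import Data.List.Relation.Unary.AllPairs using (AllPairs; []; _∷_)
open import Data.List.Membership.Propositional using () renaming (_∈_ to _∈ₗ_)
open import Data.List.Membership.Propositional.Properties using (∈-cartesianProduct⁺; ∈-allFin)
open import Function using (flip; _∘_)
open import Function.Bundles using (Equivalence)
open import Induction.WellFounded using (Acc; acc)
open import Relation.Binary.Construct.Closure.Transitive using (TransClosure; [_]; _∷_; _++_)
open import Relation.Binary.Construct.Closure.ReflexiveTransitive as Star using (Star; ε; _◅_; _◅◅_)
open import Relation.Binary.Definitions using (DecidableEquality)
open import Relation.Binary.Structures using (IsStrictPartialOrder)
open import Relation.Binary.PropositionalEquality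
open import Relation.Nullary using (¬_; Dec; yes; no; ¬?; contradiction)
open import Relation.Nullary.Decidable using (map′; _×-dec_; _⊎-dec_)

x∈p─q⇒x∉q : ∀ {n} {x : Fin n} {p q : Subset n} → x ∈ p ─ q → x ∉ q
x∈p─q⇒x∉q {p = _ ∷ p} {inside  ∷ q} (there x∈) (there x∈q) = x∈p─q⇒x∉q {p = p} x∈ x∈q
x∈p─q⇒x∉q {p = _ ∷ p} {outside ∷ q} (there x∈) (there x∈q) = x∈p─q⇒x∉q {p = p} x∈ x∈q

∣p∣≤∣q∣+∣p─q∣ : ∀ {n} (p q : Subset n) → ∣ p ∣ ≤ ∣ q ∣ + ∣ p ─ q ∣
∣p∣≤∣q∣+∣p─q∣ []            []            = z≤n
∣p∣≤∣q∣+∣p─q∣ (outside ∷ p) (outside ∷ q) = ∣p∣≤∣q∣+∣p─q∣ p q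
∣p∣≤∣q∣+∣p─q∣ (inside  ∷ p) (outside ∷ q) =
  subst (suc ∣ p ∣ ≤_) (sym (ℕ.+-suc ∣ q ∣ ∣ p ─ q ∣)) (s≤s (∣p∣≤∣q∣+∣p─q∣ p q))
∣p∣≤∣q∣+∣p─q∣ (outside ∷ p) (inside  ∷ q) = ℕ.m≤n⇒m≤1+n (∣p∣≤∣q∣+∣p─q∣ p q)
∣p∣≤∣q∣+∣p─q∣ (inside  ∷ p) (inside  ∷ q) = s≤s (∣p∣≤∣q∣+∣p─q∣ p q)

∣p∣≤1+∣p-x∣ : ∀ {n} (p : Subset n) x → ∣ p ∣ ≤ suc ∣ p - x ∣
∣p∣≤1+∣p-x∣ p x = subst (λ k → ∣ p ∣ ≤ k + ∣ p - x ∣) (∣⁅x⁆∣≡1 x) (∣p∣≤∣q∣+∣p─q∣ p ⁅ x ⁆)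

injection⇒∣p∣≤∣q∣ : ∀ {n} {p q : Subset n} (R : Fin n → Fin n → Set) →
  (∀ {x} → x ∈ p → ∃[ y ] y ∈ q × R x y) →
  (∀ {x x′ y} → x ∈ p → x′ ∈ p → R x y → R x′ y → x ≡ x′) →
  ∣ p ∣ ≤ ∣ q ∣
injection⇒∣p∣≤∣q∣ {n} {p} R = bounded ∣ p ∣ ℕ.≤-refl
  where
  bounded : ∀ k {p q : Subset n} → ∣ p ∣ ≤ k →
    (∀ {x} → x ∈ p → ∃[ y ] y ∈ q × R x y) →
    (∀ {x x′ y} → x ∈ p → x′ ∈ p → R x y → R x′ y → x ≡ x′) →
    ∣ p ∣ ≤ ∣ q ∣
  bounded k {p} {q} _ _ _ with nonempty? p
  ... | no ∄x = subst (_≤ ∣ q ∣) (sym (trans (cong ∣_∣ (Empty-unique ∄x)) (∣⊥∣≡0 n))) z≤n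
  bounded zero {p} ∣p∣≤0 _ _ | yes (x , x∈p) =
    contradiction (ℕ.≤-trans (x∈p⇒∣p-x∣<∣p∣ x∈p) ∣p∣≤0) λ ()
  bounded (suc k) {p} {q} ∣p∣≤1+k image injective | yes (x , x∈p)
    with y , y∈q , xRy ← image x∈p = begin
      ∣ p ∣          ≤⟨ ∣p∣≤1+∣p-x∣ p x ⟩
      suc ∣ p - x ∣  ≤⟨ s≤s (bounded k ∣p-x∣≤k image′ injective′) ⟩
      suc ∣ q - y ∣  ≤⟨ x∈p⇒∣p-x∣<∣p∣ y∈q ⟩
      ∣ q ∣          ∎
    where
    open ℕ.≤-Reasoning

    ∣p-x∣≤k : ∣ p - x ∣ ≤ k
    ∣p-x∣≤k = ℕ.≤-pred (ℕ.≤-trans (x∈p⇒∣p-x∣<∣p∣ x∈p) ∣p∣≤1+k)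

    ∈p-x⇒∈p : ∀ {z} → z ∈ p - x → z ∈ p
    ∈p-x⇒∈p = p─q⊆p p ⁅ x ⁆

    injective′ : ∀ {z z′ w} → z ∈ p - x → z′ ∈ p - x → R z w → R z′ w → z ≡ z′
    injective′ z∈ z′∈ = injective (∈p-x⇒∈p z∈) (∈p-x⇒∈p z′∈)

    -- Injectivity keeps the images of the remaining elements away from y.
    image′ : ∀ {z} → z ∈ p - x → ∃[ w ] w ∈ q - y × R z w
    image′ {z} z∈p-x with w , w∈q , zRw ← image (∈p-x⇒∈p z∈p-x) =
      w , x∈p∧x≢y⇒x∈p-y w∈q w≢y , zRw
      where
      w≢y : w ≢ y
      w≢y refl = x∉⁅y⁆⇒x≢y (x∈p─q⇒x∉q {p = p} z∈p-x) (injective (∈p-x⇒∈p z∈p-x) x∈p zRw xRy)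

module _ {X : Set} {R : X → X → Set} where

  ◅*⇒⁺ : ∀ {x y z} → R x y → Star R y z → TransClosure R x z
  ◅*⇒⁺ r ε       = [ r ]
  ◅*⇒⁺ r (s ◅ p) = r ∷ ◅*⇒⁺ s p

  ⁺⇒* : ∀ {x y} → TransClosure R x y → Star R x y
  ⁺⇒* [ r ]   = r ◅ ε
  ⁺⇒* (r ∷ p) = r ◅ ⁺⇒* p

  *⇒⁺ : ∀ {x y} → x ≢ y → Star R x y → TransClosure R x y
  *⇒⁺ x≢x ε       = ⊥-elim (x≢x refl)
  *⇒⁺ _   (r ◅ p) = ◅*⇒⁺ r p

  ⁺-map : ∀ {S : X → X → Set} → (∀ {x y} → R x y → S x y) →
          ∀ {x y} → TransClosure R x y → TransClosure S x y
  ⁺-map f [ r ]   = [ f r ]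
  ⁺-map f (r ∷ p) = f r ∷ ⁺-map f p

module AcyclicDigraph {n : ℕ} (A : Arcs n) (acyclic : Acyclic A) where

  _⟶_ : Fin n → Fin n → Set
  x ⟶ y = x ⟶[ A ] y

  _⟶⁺_ : Fin n → Fin n → Set
  _⟶⁺_ = TransClosure _⟶_

  ⟶-irrefl : ∀ {x y} → x ⟶ y → x ≢ y
  ⟶-irrefl x⟶x refl = acyclic _ [ x⟶x ]

  ⟶⁺-isStrictPartialOrder : IsStrictPartialOrder _≡_ _⟶⁺_
  ⟶⁺-isStrictPartialOrder = record
    { isEquivalence = isEquivalence
    ; irrefl        = λ { refl → acyclic _ }
    ; trans         = _++_
    ; <-resp-≈      = (λ { refl p → p }) , (λ { refl p → p })
    }

  reachable? : ∀ x y → Dec (x ⟶⁺ y)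
  reachable? x = go x (spo-noetherian ⟶⁺-isStrictPartialOrder x)
    where
    go : ∀ x → Acc (flip _⟶⁺_) x → ∀ y → Dec (x ⟶⁺ y)
    go x (acc rec) y with A x y in x⟶y
    ... | true  = yes [ x⟶y ]
    ... | false = map′ (λ (z , x⟶z , z⟶⁺y) → x⟶z ∷ z⟶⁺y) viaSuccessor (Fin.any? step?)
      where
      step? : ∀ z → Dec (x ⟶ z × z ⟶⁺ y)
      step? z with A x z in x⟶z
      ... | false = no λ ()
      ... | true  = map′ (refl ,_) proj₂ (go z (rec [ x⟶z ]) y)
      viaSuccessor : x ⟶⁺ y → ∃[ z ] x ⟶ z × z ⟶⁺ y
      viaSuccessor (x⟶z ∷ z⟶⁺y) = _ , x⟶z , z⟶⁺y
      viaSuccessor [ x⟶y′ ] with () ← trans (sym x⟶y′) x⟶y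

  _⟶*_ : Fin n → Fin n → Set
  _⟶*_ = Star _⟶_

  Reversible : Fin n → Fin n → Set
  Reversible u v = u ⟶ v × AcyclicRel (reverseArc A u v)

  Detour : Fin n → Fin n → Set
  Detour u v = ∃[ z ] u ⟶ z × z ≢ v × z ⟶⁺ v

  module _ {u v : Fin n} where

    private
      _⟶ʳ_ : Fin n → Fin n → Set
      _⟶ʳ_ = reverseArc A u v

      _⟶′_ : Fin n → Fin n → Set
      x ⟶′ y = x ⟶ y × ¬ (x ≡ u × y ≡ v)

    lift-path : ∀ {x y} → ¬ x ⟶* u → x ⟶⁺ y → TransClosure _⟶ʳ_ x y
    lift-path x↛u [ x⟶y ]       = [ inj₁ (x⟶y , λ { (refl , _) → x↛u ε }) ]
    lift-path x↛u (x⟶y ∷ y⟶⁺z) =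
      inj₁ (x⟶y , λ { (refl , _) → x↛u ε }) ∷ lift-path (x↛u ∘ (x⟶y ◅_)) y⟶⁺z

    reversible⇒¬detour : Reversible u v → ¬ Detour u v
    reversible⇒¬detour (_ , acyclicʳ) (z , u⟶z , z≢v , z⟶⁺v) =
      acyclicʳ v (inj₂ (refl , refl) ∷ inj₁ (u⟶z , z≢v ∘ proj₂) ∷ lift-path z↛u z⟶⁺v)
      where
      z↛u : ¬ z ⟶* u
      z↛u z⟶*u = acyclic u (◅*⇒⁺ u⟶z z⟶*u)

    split : ∀ {x y} → TransClosure _⟶ʳ_ x y →
            TransClosure _⟶′_ x y ⊎ (Star _⟶′_ x v × Star _⟶′_ u y)
    split [ inj₁ x⟶′y ]          = inj₁ [ x⟶′y ]
    split [ inj₂ (refl , refl) ] = inj₂ (ε , ε)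
    split (inj₁ x⟶′y ∷ p) with split p
    ... | inj₁ q         = inj₁ (x⟶′y ∷ q)
    ... | inj₂ (q₁ , q₂) = inj₂ (x⟶′y ◅ q₁ , q₂)
    split (inj₂ (refl , refl) ∷ p) with split p
    ... | inj₁ q         = inj₂ (ε , ⁺⇒* q)
    ... | inj₂ (_ , q₂)  = inj₂ (ε , q₂)

    ¬detour⇒reversible : u ⟶ v → ¬ Detour u v → Reversible u v
    ¬detour⇒reversible u⟶v ¬detour = u⟶v , acyclicʳ
      where
      detour : Star _⟶′_ u v → Detour u v
      detour ε = ⊥-elim (⟶-irrefl u⟶v refl)
      detour ((u⟶z , ¬uv) ◅ z⟶′*v) =
        _ , u⟶z , z≢v , *⇒⁺ z≢v (Star.map proj₁ z⟶′*v)
        where z≢v = λ z≡v → ¬uv (refl , z≡v)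
      acyclicʳ : AcyclicRel _⟶ʳ_
      acyclicʳ w cycle with split cycle
      ... | inj₁ cycle′         = acyclic w (⁺-map proj₁ cycle′)
      ... | inj₂ (w⟶′*v , u⟶′*w) = ¬detour (detour (u⟶′*w ◅◅ w⟶′*v))

  reversible? : ∀ u v → Dec (Reversible u v)
  reversible? u v with A u v Bool.≟ true
  ... | no ¬u⟶v = no (¬u⟶v ∘ proj₁)
  ... | yes u⟶v = map′ (¬detour⇒reversible u⟶v) reversible⇒¬detour (¬? (Fin.any? detour?))
    where
    detour? : ∀ z → Dec (u ⟶ z × z ≢ v × z ⟶⁺ v)
    detour? z = (A u z Bool.≟ true) ×-dec (¬? (z Fin.≟ v)) ×-dec reachable? z v

  Linked : Fin n → Fin n → Set
  Linked u v = Reversible u v ⊎ Reversible v u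

  -- If w ⟶ y is reversible, w ⟶ y ⟶ z is a detour for w ⟶ z and w ⟶ y ⟶ z ⟶ w a cycle;
  -- symmetrically if y ⟶ w is reversible.
  ¬linked-to-path : ∀ {w x y z} → x ⟶ y → y ⟶ z → Linked w x → Linked w y → Linked w z → ⊥
  ¬linked-to-path x⟶y y⟶z _ (inj₁ (w⟶y , _)) (inj₁ w↝z) =
    reversible⇒¬detour w↝z (_ , w⟶y , ⟶-irrefl y⟶z , [ y⟶z ])
  ¬linked-to-path x⟶y y⟶z _ (inj₁ (w⟶y , _)) (inj₂ (z⟶w , _)) =
    acyclic _ (w⟶y ∷ y⟶z ∷ [ z⟶w ])
  ¬linked-to-path x⟶y y⟶z (inj₂ x↝w) (inj₂ (y⟶w , _)) _ =
    reversible⇒¬detour x↝w (_ , x⟶y , ⟶-irrefl y⟶w , [ y⟶w ])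
  ¬linked-to-path x⟶y y⟶z (inj₁ (w⟶x , _)) (inj₂ (y⟶w , _)) _ =
    acyclic _ (x⟶y ∷ y⟶w ∷ [ w⟶x ])

  Comparable : Fin n → Fin n → Set
  Comparable x y = x ⟶ y ⊎ y ⟶ x

  ¬linked-to-triangle : ∀ {w a b c} → Comparable a b → Comparable b c → Comparable a c →
                        Linked w a → Linked w b → Linked w c → ⊥
  ¬linked-to-triangle (inj₁ a⟶b) (inj₁ b⟶c) _          wa wb wc = ¬linked-to-path a⟶b b⟶c wa wb wc
  ¬linked-to-triangle (inj₁ a⟶b) (inj₂ c⟶b) (inj₁ a⟶c) wa wb wc = ¬linked-to-path a⟶c c⟶b wa wc wb
  ¬linked-to-triangle (inj₁ a⟶b) (inj₂ c⟶b) (inj₂ c⟶a) wa wb wc = ¬linked-to-path c⟶a a⟶b wc wa wb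
  ¬linked-to-triangle (inj₂ b⟶a) (inj₂ c⟶b) _          wa wb wc = ¬linked-to-path c⟶b b⟶a wc wb wa
  ¬linked-to-triangle (inj₂ b⟶a) (inj₁ b⟶c) (inj₁ a⟶c) wa wb wc = ¬linked-to-path b⟶a a⟶c wb wa wc
  ¬linked-to-triangle (inj₂ b⟶a) (inj₁ b⟶c) (inj₂ c⟶a) wa wb wc = ¬linked-to-path b⟶c c⟶a wb wc wa

module NodeDisjointArcs {V : Set} (_≟_ : DecidableEquality V) where

  IsEndpoint : V → V × V → Set
  IsEndpoint w e = w ≡ proj₁ e ⊎ w ≡ proj₂ e

  Covered : List (V × V) → V → Set
  Covered P w = Any (IsEndpoint w) P

  Disjoint : V × V → V × V → Set
  Disjoint (a , b) (c , d) = a ≢ c × a ≢ d × b ≢ c × b ≢ d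

  covered? : ∀ P w → Dec (Covered P w)
  covered? P w = any? (λ e → (w ≟ proj₁ e) ⊎-dec (w ≟ proj₂ e)) P

  disjoint⇒¬shared : ∀ {e f w} → Disjoint e f → IsEndpoint w e → ¬ IsEndpoint w f
  disjoint⇒¬shared (a≢c , _ , _ , _) (inj₁ w≡a) (inj₁ w≡c) = a≢c (trans (sym w≡a) w≡c)
  disjoint⇒¬shared (_ , a≢d , _ , _) (inj₁ w≡a) (inj₂ w≡d) = a≢d (trans (sym w≡a) w≡d)
  disjoint⇒¬shared (_ , _ , b≢c , _) (inj₂ w≡b) (inj₁ w≡c) = b≢c (trans (sym w≡b) w≡c)
  disjoint⇒¬shared (_ , _ , _ , b≢d) (inj₂ w≡b) (inj₂ w≡d) = b≢d (trans (sym w≡b) w≡d)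

  uncovered⇒disjoint : ∀ {P u v} → ¬ Covered P u → ¬ Covered P v → All (Disjoint (u , v)) P
  uncovered⇒disjoint {P} u∉P v∉P = All.zipWith
    (λ (u∉f , v∉f) → u∉f ∘ inj₁ , u∉f ∘ inj₂ , v∉f ∘ inj₁ , v∉f ∘ inj₂)
    (¬Any⇒All¬ P u∉P , ¬Any⇒All¬ P v∉P)

  disjoint⇒uncovered : ∀ {e P w} → All (Disjoint e) P → IsEndpoint w e → ¬ Covered P w
  disjoint⇒uncovered disjoint w∈e = All¬⇒¬Any (All.map (λ d → disjoint⇒¬shared d w∈e) disjoint)

  module _ (Q : V → V → Set) where

    Dominates : List (V × V) → List (V × V) → Set
    Dominates P L = ∀ {u v} → (u , v) ∈ₗ L → Q u v → Covered P u ⊎ Covered P v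

    record MaximalDisjointArcs (L : List (V × V)) : Set where
      constructor mkMaximal
      field
        arcs      : List (V × V)
        related   : All (λ e → Q (proj₁ e) (proj₂ e)) arcs
        disjoint  : AllPairs Disjoint arcs
        dominates : Dominates arcs L

    greedy : (∀ u v → Dec (Q u v)) → (L : List (V × V)) → MaximalDisjointArcs L
    greedy Q? [] = mkMaximal [] [] [] λ ()
    greedy Q? ((u , v) ∷ L) with mkMaximal P QP disjointP dominatesP ← greedy Q? L =
      extend (Q? u v) (covered? P u) (covered? P v)
      where
      keep : (Q u v → Covered P u ⊎ Covered P v) → MaximalDisjointArcs ((u , v) ∷ L)
      keep covers-uv = mkMaximal P QP disjointP λ { (here refl) → covers-uv ; (there m) → dominatesP m }

      extend : Dec (Q u v) → Dec (Covered P u) → Dec (Covered P v) → MaximalDisjointArcs ((u , v) ∷ L)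
      extend (no ¬Quv) _         _         = keep (⊥-elim ∘ ¬Quv)
      extend (yes _)   (yes u∈P) _         = keep (λ _ → inj₁ u∈P)
      extend (yes _)   (no _)    (yes v∈P) = keep (λ _ → inj₂ v∈P)
      extend (yes Quv) (no u∉P)  (no v∉P)  =
        mkMaximal ((u , v) ∷ P) (Quv ∷ QP) (uncovered⇒disjoint u∉P v∉P ∷ disjointP)
        λ { (here refl) _ → inj₁ (here (inj₁ refl))
          ; (there m) → Sum.map there there ∘ dominatesP m }

  Partner : List (V × V) → V → V → Set
  Partner P x y = Any (λ e → e ≡ (x , y) ⊎ e ≡ (y , x)) P

  partner-sym : ∀ {P x y} → Partner P x y → Partner P y x
  partner-sym = Any.map Sum.swap

  partnerArc⇒endpoint : ∀ {e x y} → e ≡ (x , y) ⊎ e ≡ (y , x) → IsEndpoint x e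
  partnerArc⇒endpoint (inj₁ refl) = inj₁ refl
  partnerArc⇒endpoint (inj₂ refl) = inj₂ refl

  partner⇒covered : ∀ {P x y} → Partner P x y → Covered P x
  partner⇒covered = Any.map partnerArc⇒endpoint

  covered⇒partner : ∀ {P x} → Covered P x → ∃[ y ] Partner P x y
  covered⇒partner (here (inj₁ refl)) = _ , here (inj₁ refl)
  covered⇒partner (here (inj₂ refl)) = _ , here (inj₂ refl)
  covered⇒partner (there x∈P) with y , p ← covered⇒partner x∈P = y , there p

  partner-unique : ∀ {P x y y′} → AllPairs Disjoint P → Partner P x y → Partner P x y′ → y ≡ y′
  partner-unique _ (here (inj₁ refl)) (here (inj₁ refl)) = refl
  partner-unique _ (here (inj₁ refl)) (here (inj₂ refl)) = refl
  partner-unique _ (here (inj₂ refl)) (here (inj₁ refl)) = refl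
  partner-unique _ (here (inj₂ refl)) (here (inj₂ refl)) = refl
  partner-unique (d ∷ _) (here p) (there p′) =
    ⊥-elim (disjoint⇒uncovered d (partnerArc⇒endpoint p) (partner⇒covered p′))
  partner-unique (d ∷ _) (there p) (here p′) =
    ⊥-elim (disjoint⇒uncovered d (partnerArc⇒endpoint p′) (partner⇒covered p))
  partner-unique (_ ∷ ds) (there p) (there p′) = partner-unique ds p p′

  partner⇒related : ∀ {Q : V → V → Set} {P x y} → All (λ e → Q (proj₁ e) (proj₂ e)) P →
                    Partner P x y → Q x y ⊎ Q y x
  partner⇒related (Qxy ∷ _) (here (inj₁ refl)) = inj₁ Qxy
  partner⇒related (Qyx ∷ _) (here (inj₂ refl)) = inj₂ Qyx
  partner⇒related (_ ∷ QP)  (there p)          = partner⇒related QP p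

module WitnessDAG {m : ℕ} {G : Graph m} (M : Matching G) (D : WDAG G) where

  open WDAG D
  open AcyclicDigraph arc acyclic
  open NodeDisjointArcs (Fin._≟_ {n})

  MLinked : Fin n → Fin n → Set
  MLinked u v = MReversible M D u v ⊎ MReversible M D v u

  mlinked⇒linked : ∀ {u v} → MLinked u v → Linked u v
  mlinked⇒linked = Sum.map proj₁ proj₁

  mlinked⇒matched : ∀ {u v} → MLinked u v → Matching.medge M (label u) (label v) ≡ true
  mlinked⇒matched (inj₁ (_ , matched)) = matched
  mlinked⇒matched (inj₂ (_ , matched)) = Matching.msym M _ _ matched

  mreversible? : ∀ u v → Dec (MReversible M D u v)
  mreversible? u v = reversible? u v ×-dec (Matching.medge M (label u) (label v) Bool.≟ true)

  sameLabel⇒comparable : ∀ {a b} → a ≢ b → label a ≡ label b → Comparable a b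
  sameLabel⇒comparable a≢b la≡lb = Equivalence.from (witness _ _ a≢b) (inj₁ la≡lb)

  ¬three-sameLabel-linked : ∀ {i w a b c} → a ≢ b → b ≢ c → a ≢ c →
    label a ≡ i → label b ≡ i → label c ≡ i → Linked w a → Linked w b → Linked w c → ⊥
  ¬three-sameLabel-linked a≢b b≢c a≢c refl lb lc = ¬linked-to-triangle
    (sameLabel⇒comparable a≢b (sym lb)) (sameLabel⇒comparable b≢c (trans lb (sym lc)))
    (sameLabel⇒comparable a≢c (sym lc))

  maximal : MaximalDisjointArcs (MReversible M D) (cartesianProduct (allFin n) (allFin n))
  maximal = greedy (MReversible M D) mreversible? (cartesianProduct (allFin n) (allFin n))

  open MaximalDisjointArcs maximal public renaming (arcs to P)

  mlinked⇒covered : ∀ {u v} → MLinked u v → Covered P u ⊎ Covered P v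
  mlinked⇒covered {u} {v} (inj₁ uv) = dominates (∈-cartesianProduct⁺ (∈-allFin u) (∈-allFin v)) uv
  mlinked⇒covered {u} {v} (inj₂ vu) = Sum.swap (dominates (∈-cartesianProduct⁺ (∈-allFin v) (∈-allFin u)) vu)

  partner-label : ∀ {u y x} → MLinked u y → Partner P y x → label x ≡ label u
  partner-label uy yx = Matching.unique M _ _ _
    (mlinked⇒matched (partner⇒related related yx)) (Matching.msym M _ _ (mlinked⇒matched uy))

  uncovered≤covered : ∀ i (U C : Subset n) →
    (∀ {u} → u ∈ U → ∃[ y ] MLinked u y × label u ≡ i × ¬ Covered P u) →
    (∀ {x} → Covered P x → label x ≡ i → x ∈ C) →
    ∣ U ∣ ≤ ∣ C ∣
  uncovered≤covered i U C inU inC = injection⇒∣p∣≤∣q∣ PartnerOfNeighbour image injective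
    where
    PartnerOfNeighbour : Fin n → Fin n → Set
    PartnerOfNeighbour u x = ∃[ y ] MLinked u y × Partner P y x

    image : ∀ {u} → u ∈ U → ∃[ x ] x ∈ C × PartnerOfNeighbour u x
    image u∈U with y , uy , lu , u∉P ← inU u∈U | mlinked⇒covered uy
    ... | inj₁ u∈P = ⊥-elim (u∉P u∈P)
    ... | inj₂ y∈P with x , yx ← covered⇒partner y∈P =
      x , inC (partner⇒covered (partner-sym yx)) (trans (partner-label uy yx) lu) , y , uy , yx

    injective : ∀ {u u′ x} → u ∈ U → u′ ∈ U →
                PartnerOfNeighbour u x → PartnerOfNeighbour u′ x → u ≡ u′
    injective {u} {u′} u∈U u′∈U (y , uy , yx) (_ , u′y , y′x)
      with refl ← partner-unique disjoint (partner-sym yx) (partner-sym y′x)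
      with u Fin.≟ u′
    ... | yes u≡u′ = u≡u′
    ... | no u≢u′ with _ , _ , lu , u∉P ← inU u∈U | _ , _ , lu′ , u′∉P ← inU u′∈U =
      ⊥-elim (¬three-sameLabel-linked u≢u′ (λ { refl → u′∉P x∈P }) (λ { refl → u∉P x∈P })
        lu lu′ (trans (partner-label uy yx) lu)
        (mlinked⇒linked (Sum.swap uy)) (mlinked⇒linked (Sum.swap u′y))
        (mlinked⇒linked (partner⇒related related yx)))
      where
      x∈P = partner⇒covered (partner-sym yx)

  ∣𝒱∣≤2*∣covered∣ : ∀ i (SV SP : Subset n) → SV Represents InVi M D i →
    SP Represents (λ w → Covered P w × label w ≡ i) → ∣ SV ∣ ≤ 2 * ∣ SP ∣
  ∣𝒱∣≤2*∣covered∣ i SV SP SV≈𝒱 SP≈covered = begin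
    ∣ SV ∣                ≤⟨ ∣p∣≤∣q∣+∣p─q∣ SV SP ⟩
    ∣ SP ∣ + ∣ SV ─ SP ∣  ≤⟨ ℕ.+-monoʳ-≤ ∣ SP ∣ (uncovered≤covered i (SV ─ SP) SP inU inC) ⟩
    ∣ SP ∣ + ∣ SP ∣       ≡⟨ cong (∣ SP ∣ +_) (sym (ℕ.+-identityʳ ∣ SP ∣)) ⟩
    2 * ∣ SP ∣            ∎
    where
    open ℕ.≤-Reasoning
    inC : ∀ {x} → Covered P x → label x ≡ i → x ∈ SP
    inC x∈P lx = Equivalence.from (SP≈covered _) (x∈P , lx)
    inU : ∀ {u} → u ∈ SV ─ SP → ∃[ y ] MLinked u y × label u ≡ i × ¬ Covered P u
    inU {u} u∈SV─SP with (y , uy) , lu ← Equivalence.to (SV≈𝒱 u) (p─q⊆p SV SP u∈SV─SP) =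
      y , uy , lu , λ u∈P → x∈p─q⇒x∉q {p = SV} u∈SV─SP (inC u∈P lu)

proposition3p2 : ∀ {m : ℕ} (G : Graph m) (M : Matching G) (D : WDAG G) →
    Σ (List (Fin (WDAG.n D) × Fin (WDAG.n D))) λ P →
      All (λ e → MReversible M D (proj₁ e) (proj₂ e)) P
      × AllPairs (NodeDisjoint M D) P
      × (∀ (i : Fin m) → MEndpoint M i →
           ∀ (SV SP : Subset (WDAG.n D)) →
           SV Represents InVi M D i →
           SP Represents (λ w → EndpointOf M D P w × WDAG.label D w ≡ i) →
           ∣ SV ∣ ≤ 2 * ∣ SP ∣)
-- The bound holds for every label i, whether or not it is matched.
proposition3p2 G M D = P , related , disjoint , λ i _ → ∣𝒱∣≤2*∣covered∣ i
  where open WitnessDAG M D
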